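{- Let $k$ be a positive integer, let $G_1,G_2$ be disjoint copies of $C_{3k+2}$, and let $f:V(G_1)\to V(G_2)$ be a function which is not a bijection. Then $\gamma(C(C_{3k+2},f))<2\gamma(C_{3k+2})=2k+2$.
   Context: For disjoint copies $G_1,G_2$ of a graph $G$ and a function $f:V(G_1)\to V(G_2)$, the functigraph $C(G,f)$ has vertex set $V(G_1)\cup V(G_2)$ and edge set $E(G_1)\cup E(G_2)\cup\{uv : u\in V(G_1), v\in V(G_2), v=f(u)\}$. $\gamma$ denotes domination number. -}

module Defs where

open import Data.Nat using (ℕ; suc; _+_; _*_; _≤_)
open import Data.Fin using (Fin; toℕ; splitAt)
open import Data.Fin.Subset using (Subset; _∈_; ∣_∣)
open import Data.Sum using (_⊎_; inj₁; inj₂)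
open import Data.Product using (Σ; ∃; _×_; _,_)
open import Data.Empty using (⊥)
open import Relation.Binary.PropositionalEquality using (_≡_)

record Graph : Set₁ where
  field
    order : ℕ
    Adj   : Fin order → Fin order → Set
open Graph public

Dominating : (G : Graph) → Subset (order G) → Set
Dominating G D = ∀ v → v ∈ D ⊎ (∃ λ u → u ∈ D × Adj G u v)

IsDominationNumber : Graph → ℕ → Set
IsDominationNumber G γ =
  (Σ (Subset (order G)) λ D → Dominating G D × ∣ D ∣ ≡ γ)
  × (∀ D → Dominating G D → γ ≤ ∣ D ∣)

-- The cycle C_n on vertices 0,…,n-1 (n ≥ 3 intended): i ~ j iff j ≡ i+1 (mod n) or i ≡ j+1 (mod n).
SuccMod : (n : ℕ) → Fin n → Fin n → Set
SuccMod (suc m) i j = toℕ j ≡ (suc (toℕ i)) Data.Nat.% (suc m)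

Cycle : ℕ → Graph
Cycle n = record
  { order = n
  ; Adj   = λ i j → SuccMod n i j ⊎ SuccMod n j i }

-- Functigraph C(G,f): vertex set Fin (n + n); the first block is G₁, the second G₂
-- (via splitAt). Edges: those of G₁, those of G₂, and u—f(u) for u ∈ G₁ (symmetrised).
FAdj : (G : Graph) → (Fin (order G) → Fin (order G)) →
       (Fin (order G) ⊎ Fin (order G)) → (Fin (order G) ⊎ Fin (order G)) → Set
FAdj G f (inj₁ a) (inj₁ b) = Adj G a b
FAdj G f (inj₂ a) (inj₂ b) = Adj G a b
FAdj G f (inj₁ a) (inj₂ b) = f a ≡ b
FAdj G f (inj₂ a) (inj₁ b) = f b ≡ a

Functigraph : (G : Graph) → (Fin (order G) → Fin (order G)) → Graph
Functigraph G f = record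
  { order = order G + order G
  ; Adj   = λ x y → FAdj G f (splitAt (order G) x) (splitAt (order G) y) }

-- γ(C_{3k+2}) = k + 1: a vertex dominates at most three vertices, and the progression c+1, c+4, …, c+3k+1
-- dominates.  The k vertices x+2, x+5, …, x+3j−1, x+3j+3, …, x+3k dominate everything except x and
-- x+3j+1, and any two vertices either form such a pair (x, x+3j+1) or lie on a common progression.
-- Given a ≠ b with f a = f b, choose x such that (x, a) is a pair and x, b lie on a progression (after
-- swapping a and b if necessary).  If f x and f a lie on a progression, take the k vertices missing x, a
-- in G₁ and that progression in G₂; otherwise (f x, f a) is a pair, and take the progression through
-- x, b in G₁ and the k vertices missing f x, f a = f b in G₂.  Either way 2k + 1 vertices dominate.

module Submission where

open import Defs
open import Data.Nat using (ℕ; zero; suc; _+_; _*_; _∸_; _≤_; _<_; z≤n; s≤s; _%_; NonZero)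
open import Data.Nat.Properties
open import Data.Nat.DivMod using (_mod_; m%n<n; m%n%n≡m%n; %-distribˡ-+; [m+kn]%n≡m%n; [m+n]%n≡m%n; m<n⇒m%n≡m)
open import Data.Nat.Tactic.RingSolver using (solve-∀)
open import Data.Fin as Fin using (Fin; toℕ; splitAt; punchOut; _↑ˡ_; _↑ʳ_)
open import Data.Fin.Properties using (any?; toℕ-injective; toℕ-fromℕ<; toℕ<n; injective⇒≤; punchOut-injective; splitAt-↑ˡ; splitAt-↑ʳ; splitAt⁻¹-↑ˡ; splitAt⁻¹-↑ʳ)
open import Data.Fin.Subset using (Subset; _∈_; _⊆_; ∣_∣; ⁅_⁆; _∪_; ⊥; ⊤; inside; outside)
open import Data.Fin.Subset.Properties using (x∈p∪q⁺; x∈⁅x⁆; ∣⁅x⁆∣≡1; ∣⊥∣≡0; ∣⊤∣≡n; p⊆q⇒∣p∣≤∣q∣; p⊆p∪q; q⊆p∪q)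
open import Data.Vec using ([]; _∷_; _++_; here; there)
open import Data.Vec.Properties using (lookup-++ˡ; lookup-++ʳ; []=⇒lookup; lookup⇒[]=)
open import Data.Product using (∃; ∃₂; _×_; _,_)
open import Data.Sum using (_⊎_; inj₁; inj₂; swap)
open import Function.Definitions using (Bijective; Injective; Surjective)
open import Relation.Nullary using (¬_; yes; no; ¬?; contradiction)
open import Relation.Nullary.Decidable using (_×-dec_; decidable-stable)
open import Relation.Binary using (tri<; tri≈; tri>)
open import Relation.Binary.PropositionalEquality
open import Function using (_∘_)

∣p∪q∣≤∣p∣+∣q∣ : ∀ {n} (p q : Subset n) → ∣ p ∪ q ∣ ≤ ∣ p ∣ + ∣ q ∣
∣p∪q∣≤∣p∣+∣q∣ []            []            = z≤n
∣p∪q∣≤∣p∣+∣q∣ (outside ∷ p) (outside ∷ q) = ∣p∪q∣≤∣p∣+∣q∣ p q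
∣p∪q∣≤∣p∣+∣q∣ (outside ∷ p) (inside  ∷ q) = ≤-trans (s≤s (∣p∪q∣≤∣p∣+∣q∣ p q)) (≤-reflexive (sym (+-suc _ _)))
∣p∪q∣≤∣p∣+∣q∣ (inside  ∷ p) (outside ∷ q) = s≤s (∣p∪q∣≤∣p∣+∣q∣ p q)
∣p∪q∣≤∣p∣+∣q∣ (inside  ∷ p) (inside  ∷ q) = s≤s (≤-trans (∣p∪q∣≤∣p∣+∣q∣ p q) (+-monoʳ-≤ ∣ p ∣ (n≤1+n _)))

∣p++q∣≡∣p∣+∣q∣ : ∀ {m n} (p : Subset m) (q : Subset n) → ∣ p ++ q ∣ ≡ ∣ p ∣ + ∣ q ∣
∣p++q∣≡∣p∣+∣q∣ []            q = refl
∣p++q∣≡∣p∣+∣q∣ (inside  ∷ p) q = cong suc (∣p++q∣≡∣p∣+∣q∣ p q)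
∣p++q∣≡∣p∣+∣q∣ (outside ∷ p) q = ∣p++q∣≡∣p∣+∣q∣ p q

x∈p⇒x↑ˡ∈p++q : ∀ {m n x} {p : Subset m} (q : Subset n) → x ∈ p → x ↑ˡ n ∈ p ++ q
x∈p⇒x↑ˡ∈p++q {x = x} {p} q x∈p = lookup⇒[]= _ (p ++ q) (trans (lookup-++ˡ p q x) ([]=⇒lookup x∈p))

x∈q⇒m↑ʳx∈p++q : ∀ {m n x} (p : Subset m) {q : Subset n} → x ∈ q → m ↑ʳ x ∈ p ++ q
x∈q⇒m↑ʳx∈p++q {x = x} p {q} x∈q = lookup⇒[]= _ (p ++ q) (trans (lookup-++ʳ p q x) ([]=⇒lookup x∈q))

image : ∀ {n} → (ℕ → Fin n) → ℕ → Subset n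
image g zero    = ⊥
image g (suc c) = ⁅ g c ⁆ ∪ image g c

∣image∣≤ : ∀ {n} (g : ℕ → Fin n) c → ∣ image g c ∣ ≤ c
∣image∣≤ {n} g zero    = ≤-reflexive (∣⊥∣≡0 n)
∣image∣≤     g (suc c) = ≤-trans (∣p∪q∣≤∣p∣+∣q∣ ⁅ g c ⁆ (image g c))
                                 (≤-trans (≤-reflexive (cong (_+ ∣ image g c ∣) (∣⁅x⁆∣≡1 (g c)))) (s≤s (∣image∣≤ g c)))

∈-image : ∀ {n} (g : ℕ → Fin n) {i c} → i < c → g i ∈ image g c
∈-image g {i} {suc c} i<1+c with i ≟ c
... | yes refl = x∈p∪q⁺ (inj₁ (x∈⁅x⁆ (g i)))
... | no  i≢c  = x∈p∪q⁺ (inj₂ (∈-image g (≤∧≢⇒< (≤-pred i<1+c) i≢c)))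

⋃[_]_ : ∀ {m n} → Subset m → (Fin m → Subset n) → Subset n
⋃[ []          ] h = ⊥
⋃[ inside  ∷ p ] h = h Fin.zero ∪ ⋃[ p ] (h ∘ Fin.suc)
⋃[ outside ∷ p ] h = ⋃[ p ] (h ∘ Fin.suc)

∣⋃[]∣≤ : ∀ {m n c} (p : Subset m) (h : Fin m → Subset n) → (∀ i → ∣ h i ∣ ≤ c) → ∣ ⋃[ p ] h ∣ ≤ ∣ p ∣ * c
∣⋃[]∣≤ {n = n} []            h ∣h∣≤c = ≤-reflexive (∣⊥∣≡0 n)
∣⋃[]∣≤         (inside  ∷ p) h ∣h∣≤c = ≤-trans (∣p∪q∣≤∣p∣+∣q∣ (h Fin.zero) _)
                                               (+-mono-≤ (∣h∣≤c Fin.zero) (∣⋃[]∣≤ p (h ∘ Fin.suc) (∣h∣≤c ∘ Fin.suc)))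
∣⋃[]∣≤         (outside ∷ p) h ∣h∣≤c = ∣⋃[]∣≤ p (h ∘ Fin.suc) (∣h∣≤c ∘ Fin.suc)

∈-⋃[] : ∀ {m n} (p : Subset m) (h : Fin m → Subset n) {i x} → i ∈ p → x ∈ h i → x ∈ ⋃[ p ] h
∈-⋃[] (inside  ∷ p) h {Fin.zero}  here      x∈h = x∈p∪q⁺ (inj₁ x∈h)
∈-⋃[] (inside  ∷ p) h {Fin.suc i} (there i∈p) x∈h = x∈p∪q⁺ (inj₂ (∈-⋃[] p (h ∘ Fin.suc) i∈p x∈h))
∈-⋃[] (outside ∷ p) h {Fin.suc i} (there i∈p) x∈h = ∈-⋃[] p (h ∘ Fin.suc) i∈p x∈h

Dominated : (G : Graph) → Subset (order G) → Fin (order G) → Set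
Dominated G D v = v ∈ D ⊎ ∃ λ u → u ∈ D × Adj G u v

dominated-mono : ∀ (G : Graph) {D D′ v} → D ⊆ D′ → Dominated G D v → Dominated G D′ v
dominated-mono G D⊆D′ (inj₁ v∈D)             = inj₁ (D⊆D′ v∈D)
dominated-mono G D⊆D′ (inj₂ (u , u∈D , u~v)) = inj₂ (u , D⊆D′ u∈D , u~v)

dominating⇒order≤ : (G : Graph) (nbhd : Fin (order G) → Subset (order G)) (c : ℕ) →
                    (∀ u → u ∈ nbhd u) → (∀ {u v} → Adj G u v → v ∈ nbhd u) → (∀ u → ∣ nbhd u ∣ ≤ c) →
                    ∀ D → Dominating G D → order G ≤ ∣ D ∣ * c
dominating⇒order≤ G nbhd c u∈nbhd adj⇒∈nbhd ∣nbhd∣≤c D dom = begin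
  order G            ≡⟨ ∣⊤∣≡n (order G) ⟨
  ∣ ⊤ {order G} ∣    ≤⟨ p⊆q⇒∣p∣≤∣q∣ ⊤⊆⋃nbhd ⟩
  ∣ ⋃[ D ] nbhd ∣    ≤⟨ ∣⋃[]∣≤ D nbhd ∣nbhd∣≤c ⟩
  ∣ D ∣ * c          ∎
  where
  open ≤-Reasoning
  ⊤⊆⋃nbhd : ⊤ ⊆ ⋃[ D ] nbhd
  ⊤⊆⋃nbhd {v} _ with dom v
  ... | inj₁ v∈D             = ∈-⋃[] D nbhd v∈D (u∈nbhd v)
  ... | inj₂ (u , u∈D , u~v) = ∈-⋃[] D nbhd u∈D (adj⇒∈nbhd u~v)

-- a value y outside the image would make punchOut y ∘ f an injection Fin (suc n) → Fin n
injective⇒surjective : ∀ {n} {f : Fin n → Fin n} → Injective _≡_ _≡_ f → Surjective _≡_ _≡_ f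
injective⇒surjective {suc n} {f} f-injective y with any? (λ x → f x Fin.≟ y)
... | yes (x , fx≡y) = x , λ { refl → fx≡y }
... | no  y∉image    = contradiction (injective⇒≤ punchOut-f-injective) 1+n≰n
  where
  y≢f : ∀ x → y ≢ f x
  y≢f x y≡fx = y∉image (x , sym y≡fx)
  punchOut-f-injective : Injective _≡_ _≡_ (λ x → punchOut (y≢f x))
  punchOut-f-injective = f-injective ∘ punchOut-injective (y≢f _) (y≢f _)

¬bijective⇒collision : ∀ {n} {f : Fin n → Fin n} → ¬ Bijective _≡_ _≡_ f → ∃₂ λ a b → a ≢ b × f a ≡ f b
¬bijective⇒collision {f = f} ¬bij with any? (λ a → any? λ b → ¬? (a Fin.≟ b) ×-dec (f a Fin.≟ f b))
... | yes (a , b , a≢b , fa≡fb) = a , b , a≢b , fa≡fb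
... | no ∄collision = contradiction ((λ {a} {b} → injective {a} {b}) , injective⇒surjective injective) ¬bij
  where
  injective : Injective _≡_ _≡_ f
  injective {a} {b} fa≡fb = decidable-stable (a Fin.≟ b) λ a≢b → ∄collision (a , b , a≢b , fa≡fb)

module _ (G : Graph) (f : Fin (order G) → Fin (order G)) where
  private
    n = order G
    F = Functigraph G f

  adj-functigraph : ∀ {x y p q} → splitAt n x ≡ p → splitAt n y ≡ q → FAdj G f p q → Adj F x y
  adj-functigraph x≡p y≡q = subst₂ (FAdj G f) (sym x≡p) (sym y≡q)

  dominated-left : ∀ {A B v a} → splitAt n v ≡ inj₁ a → Dominated G A a ⊎ f a ∈ B → Dominated F (A ++ B) v
  dominated-left {A} {B} v≡a (inj₁ (inj₁ a∈A)) =
    inj₁ (subst (_∈ A ++ B) (splitAt⁻¹-↑ˡ v≡a) (x∈p⇒x↑ˡ∈p++q B a∈A))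
  dominated-left {A} {B} v≡a (inj₁ (inj₂ (u , u∈A , u~a))) =
    inj₂ (u ↑ˡ n , x∈p⇒x↑ˡ∈p++q B u∈A , adj-functigraph (splitAt-↑ˡ n u n) v≡a u~a)
  dominated-left {A} {B} {a = a} v≡a (inj₂ fa∈B) =
    inj₂ (n ↑ʳ f a , x∈q⇒m↑ʳx∈p++q A fa∈B , adj-functigraph (splitAt-↑ʳ n n (f a)) v≡a refl)

  dominated-right : ∀ {A B v b} → splitAt n v ≡ inj₂ b → Dominated G B b ⊎ (∃ λ a → a ∈ A × f a ≡ b) →
                    Dominated F (A ++ B) v
  dominated-right {A} {B} v≡b (inj₁ (inj₁ b∈B)) =
    inj₁ (subst (_∈ A ++ B) (splitAt⁻¹-↑ʳ v≡b) (x∈q⇒m↑ʳx∈p++q A b∈B))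
  dominated-right {A} {B} v≡b (inj₁ (inj₂ (u , u∈B , u~b))) =
    inj₂ (n ↑ʳ u , x∈q⇒m↑ʳx∈p++q A u∈B , adj-functigraph (splitAt-↑ʳ n n u) v≡b u~b)
  dominated-right {A} {B} v≡b (inj₂ (a , a∈A , fa≡b)) =
    inj₂ (a ↑ˡ n , x∈p⇒x↑ˡ∈p++q B a∈A , adj-functigraph (splitAt-↑ˡ n a n) v≡b fa≡b)

  functigraph-dominating : ∀ A B → (∀ a → Dominated G A a ⊎ f a ∈ B) →
                           (∀ b → Dominated G B b ⊎ ∃ λ a → a ∈ A × f a ≡ b) → Dominating F (A ++ B)
  functigraph-dominating A B cover₁ cover₂ v = bySide (splitAt n v) refl
    where
    bySide : ∀ s → splitAt n v ≡ s → Dominated F (A ++ B) v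
    bySide (inj₁ a) v≡a = dominated-left v≡a (cover₁ a)
    bySide (inj₂ b) v≡b = dominated-right v≡b (cover₂ b)

data DivMod3 : ℕ → Set where
  3q   : ∀ q → DivMod3 (q * 3)
  3q+1 : ∀ q → DivMod3 (1 + q * 3)
  3q+2 : ∀ q → DivMod3 (2 + q * 3)

divMod3 : ∀ m → DivMod3 m
divMod3 zero = 3q 0
divMod3 (suc m) with divMod3 m
... | 3q   q = 3q+1 q
... | 3q+1 q = 3q+2 q
... | 3q+2 q = 3q (suc q)

[m%d+n]%d≡[m+n]%d : ∀ m n d .{{_ : NonZero d}} → (m % d + n) % d ≡ (m + n) % d
[m%d+n]%d≡[m+n]%d m n d = begin
  (m % d + n) % d           ≡⟨ %-distribˡ-+ (m % d) n d ⟩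
  (m % d % d + n % d) % d   ≡⟨ cong (λ x → (x + n % d) % d) (m%n%n≡m%n m d) ⟩
  (m % d + n % d) % d       ≡⟨ %-distribˡ-+ m n d ⟨
  (m + n) % d               ∎
  where open ≡-Reasoning

quotient<-cancel : ∀ r q {q′} → r + q * 3 < q′ * 3 → q < q′
quotient<-cancel r q {q′} lt = *-cancelʳ-< 3 q q′ (≤-<-trans (m≤n+m (q * 3) r) lt)

module CycleGraph (n : ℕ) where
  N : ℕ
  N = suc n

  C : Graph
  C = Cycle N

  infixl 6 _⊕_
  _⊕_ : Fin N → ℕ → Fin N
  v ⊕ t = (toℕ v + t) mod N

  toℕ-⊕ : ∀ v t → toℕ (v ⊕ t) ≡ (toℕ v + t) % N
  toℕ-⊕ v t = toℕ-fromℕ< _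

  ⊕-assoc : ∀ v s t → v ⊕ s ⊕ t ≡ v ⊕ (s + t)
  ⊕-assoc v s t = toℕ-injective (begin
    toℕ (v ⊕ s ⊕ t)            ≡⟨ toℕ-⊕ (v ⊕ s) t ⟩
    (toℕ (v ⊕ s) + t) % N      ≡⟨ cong (λ x → (x + t) % N) (toℕ-⊕ v s) ⟩
    ((toℕ v + s) % N + t) % N  ≡⟨ [m%d+n]%d≡[m+n]%d (toℕ v + s) t N ⟩
    (toℕ v + s + t) % N        ≡⟨ cong (_% N) (+-assoc (toℕ v) s t) ⟩
    (toℕ v + (s + t)) % N      ≡⟨ toℕ-⊕ v (s + t) ⟨
    toℕ (v ⊕ (s + t))          ∎)
    where open ≡-Reasoning

  ⊕-identityʳ : ∀ v → v ⊕ 0 ≡ v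
  ⊕-identityʳ v = toℕ-injective (trans (toℕ-⊕ v 0)
    (trans (cong (_% N) (+-identityʳ (toℕ v))) (m<n⇒m%n≡m (toℕ<n v))))

  ⊕-N : ∀ v → v ⊕ N ≡ v
  ⊕-N v = toℕ-injective (trans (toℕ-⊕ v N) (trans ([m+n]%n≡m%n (toℕ v) N) (m<n⇒m%n≡m (toℕ<n v))))

  prev : Fin N → Fin N
  prev v = v ⊕ n

  prev⊕suc : ∀ v t → prev v ⊕ suc t ≡ v ⊕ t
  prev⊕suc v t = begin
    prev v ⊕ suc t       ≡⟨ ⊕-assoc v n (suc t) ⟩
    v ⊕ (n + suc t)      ≡⟨ cong (v ⊕_) (trans (+-suc n t) (+-comm N t)) ⟩
    v ⊕ (t + N)          ≡⟨ ⊕-assoc v t N ⟨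
    v ⊕ t ⊕ N            ≡⟨ ⊕-N (v ⊕ t) ⟩
    v ⊕ t                ∎
    where open ≡-Reasoning

  prev[⊕1] : ∀ v → prev (v ⊕ 1) ≡ v
  prev[⊕1] v = trans (⊕-assoc v 1 n) (⊕-N v)

  -- the residue of toℕ v − toℕ u, written without subtraction since −a ≡ n·a (mod N)
  offset : ∀ u v → ∃ λ d → d < N × v ≡ u ⊕ d
  offset u v = d , m%n<n (toℕ v + n * toℕ u) N , toℕ-injective (sym (begin
    toℕ (u ⊕ d)                            ≡⟨ toℕ-⊕ u d ⟩
    (toℕ u + d) % N                        ≡⟨ cong (_% N) (+-comm (toℕ u) d) ⟩
    (d + toℕ u) % N                        ≡⟨ [m%d+n]%d≡[m+n]%d (toℕ v + n * toℕ u) (toℕ u) N ⟩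
    (toℕ v + n * toℕ u + toℕ u) % N        ≡⟨ cong (_% N) (identity (toℕ v) (toℕ u) n) ⟩
    (toℕ v + toℕ u * N) % N                ≡⟨ [m+kn]%n≡m%n (toℕ v) (toℕ u) N ⟩
    toℕ v % N                              ≡⟨ m<n⇒m%n≡m (toℕ<n v) ⟩
    toℕ v                                  ∎))
    where
    open ≡-Reasoning
    d = (toℕ v + n * toℕ u) % N
    identity : ∀ b a n → b + n * a + a ≡ b + a * suc n
    identity = solve-∀

  succMod⇒≡⊕1 : ∀ {u v} → SuccMod N u v → v ≡ u ⊕ 1
  succMod⇒≡⊕1 {u} {v} u↦v = toℕ-injective (trans u↦v (trans (cong (_% N) (+-comm 1 (toℕ u))) (sym (toℕ-⊕ u 1))))

  adj-⊕suc : ∀ v t → Adj C (v ⊕ t) (v ⊕ suc t)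
  adj-⊕suc v t = inj₁ (begin
    toℕ (v ⊕ suc t)          ≡⟨ cong toℕ (trans (cong (v ⊕_) (+-comm 1 t)) (sym (⊕-assoc v t 1))) ⟩
    toℕ (v ⊕ t ⊕ 1)          ≡⟨ toℕ-⊕ (v ⊕ t) 1 ⟩
    (toℕ (v ⊕ t) + 1) % N    ≡⟨ cong (_% N) (+-comm (toℕ (v ⊕ t)) 1) ⟩
    suc (toℕ (v ⊕ t)) % N    ∎)
    where open ≡-Reasoning

  adj-sym : ∀ {u v} → Adj C u v → Adj C v u
  adj-sym = swap

  closedNbhd : Fin N → Subset N
  closedNbhd u = ⁅ u ⁆ ∪ (⁅ u ⊕ 1 ⁆ ∪ ⁅ prev u ⁆)

  ∣closedNbhd∣≤3 : ∀ u → ∣ closedNbhd u ∣ ≤ 3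
  ∣closedNbhd∣≤3 u = ≤-trans (∣p∪q∣≤∣p∣+∣q∣ ⁅ u ⁆ _) (+-mono-≤ (≤-reflexive (∣⁅x⁆∣≡1 u))
                       (≤-trans (∣p∪q∣≤∣p∣+∣q∣ ⁅ u ⊕ 1 ⁆ _) (≤-reflexive (cong₂ _+_ (∣⁅x⁆∣≡1 (u ⊕ 1)) (∣⁅x⁆∣≡1 (prev u))))))

  adj⇒∈closedNbhd : ∀ {u v} → Adj C u v → v ∈ closedNbhd u
  adj⇒∈closedNbhd {u} {v} (inj₁ u↦v) rewrite succMod⇒≡⊕1 u↦v = x∈p∪q⁺ (inj₂ (x∈p∪q⁺ (inj₁ (x∈⁅x⁆ (u ⊕ 1)))))
  adj⇒∈closedNbhd {u} {v} (inj₂ v↦u) rewrite succMod⇒≡⊕1 v↦u | prev[⊕1] v = x∈p∪q⁺ (inj₂ (x∈p∪q⁺ (inj₂ (x∈⁅x⁆ v))))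

  dominating⇒N≤∣D∣*3 : ∀ D → Dominating C D → N ≤ ∣ D ∣ * 3
  dominating⇒N≤∣D∣*3 = dominating⇒order≤ C closedNbhd 3 (λ u → x∈p∪q⁺ (inj₁ (x∈⁅x⁆ u))) adj⇒∈closedNbhd ∣closedNbhd∣≤3

  run : Fin N → ℕ → Subset N
  run c = image (λ i → c ⊕ suc (i * 3))

  ∈-run : ∀ c q {i} → i < q → c ⊕ suc (i * 3) ∈ run c q
  ∈-run c q = ∈-image (λ i → c ⊕ suc (i * 3))

  ∣run∣≤ : ∀ c q → ∣ run c q ∣ ≤ q
  ∣run∣≤ c = ∣image∣≤ (λ i → c ⊕ suc (i * 3))

  run-dominates : ∀ c q m → m < q * 3 → Dominated C (run c q) (c ⊕ m)
  run-dominates c q m m<3q with divMod3 m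
  ... | 3q   i = inj₂ (c ⊕ suc (i * 3) , ∈-run c q (quotient<-cancel 0 i m<3q) , adj-sym (adj-⊕suc c (i * 3)))
  ... | 3q+1 i = inj₁ (∈-run c q (quotient<-cancel 1 i m<3q))
  ... | 3q+2 i = inj₂ (c ⊕ suc (i * 3) , ∈-run c q (quotient<-cancel 2 i m<3q) , adj-⊕suc c (suc (i * 3)))

  run-dominating : ∀ c q → N ≤ q * 3 → Dominating C (run c q)
  run-dominating c q N≤3q v with offset c v
  ... | d , d<N , refl = run-dominates c q d (<-≤-trans d<N N≤3q)

module Cycle3k+2 (k : ℕ) where
  n : ℕ
  n = suc (3 * k)

  open CycleGraph n

  k*3<N : k * 3 < N
  k*3<N = s≤s (≤-trans (≤-reflexive (*-comm k 3)) (n≤1+n _))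

  N≤[1+k]*3 : N ≤ suc k * 3
  N≤[1+k]*3 = s≤s (s≤s (≤-trans (≤-reflexive (*-comm 3 k)) (n≤1+n _)))

  progression : Fin N → Subset N
  progression c = run c (suc k)

  progression-dominating : ∀ c → Dominating C (progression c)
  progression-dominating c = run-dominating c (suc k) N≤[1+k]*3

  cycle-domination-number : ∀ {γ} → IsDominationNumber C γ → γ ≡ suc k
  cycle-domination-number ((D , D-dominating , ∣D∣≡γ) , minimal) = ≤-antisym
    (≤-trans (minimal (progression Fin.zero) (progression-dominating Fin.zero)) (∣run∣≤ Fin.zero (suc k)))
    (subst (suc k ≤_) ∣D∣≡γ (*-cancelʳ-< 3 k ∣ D ∣ (<-≤-trans k*3<N (dominating⇒N≤∣D∣*3 D D-dominating))))

  gapped : Fin N → ℕ → Subset N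
  gapped s j = run (s ⊕ 1) j ∪ run (s ⊕ (2 + j * 3)) (k ∸ j)

  ∣gapped∣≤k : ∀ s {j} → j ≤ k → ∣ gapped s j ∣ ≤ k
  ∣gapped∣≤k s {j} j≤k = ≤-trans (∣p∪q∣≤∣p∣+∣q∣ (run (s ⊕ 1) j) _)
    (≤-trans (+-mono-≤ (∣run∣≤ (s ⊕ 1) j) (∣run∣≤ (s ⊕ (2 + j * 3)) (k ∸ j))) (≤-reflexive (m+[n∸m]≡n j≤k)))

  remainder<[k∸j]*3 : ∀ j t → suc (j * 3) + t ≤ 3 * k → t < (k ∸ j) * 3
  remainder<[k∸j]*3 j t le = subst (t <_) (sym (*-distribʳ-∸ 3 k j))
    (m+n≤o⇒m≤o∸n (suc t) (subst₂ _≤_ (cong suc (+-comm (j * 3) t)) (*-comm 3 k) le))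

  gapped-dominates : ∀ s {j} → j ≤ k → ∀ v → v ≡ s ⊎ v ≡ s ⊕ suc (j * 3) ⊎ Dominated C (gapped s j) v
  gapped-dominates s {j} j≤k v with offset s v
  ... | zero  , _   , v≡s⊕0 = inj₁ (trans v≡s⊕0 (⊕-identityʳ s))
  ... | suc m , m<N , refl with <-cmp m (j * 3)
  ...   | tri≈ _ m≡3j _ = inj₂ (inj₁ (cong (λ x → s ⊕ suc x) m≡3j))
  ...   | tri< m<3j _ _ = inj₂ (inj₂ (subst (Dominated C (gapped s j)) (⊕-assoc s 1 m)
                            (dominated-mono C (p⊆p∪q _) (run-dominates (s ⊕ 1) j m m<3j))))
  ...   | tri> _ _ 3j<m = inj₂ (inj₂ (subst (Dominated C (gapped s j)) s⊕2+3j⊕t≡v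
                            (dominated-mono C (q⊆p∪q _ _) (run-dominates (s ⊕ (2 + j * 3)) (k ∸ j) t t<))))
    where
    t = m ∸ suc (j * 3)
    m≡ : suc (j * 3) + t ≡ m
    m≡ = m+[n∸m]≡n 3j<m
    t< : t < (k ∸ j) * 3
    t< = remainder<[k∸j]*3 j t (subst (_≤ 3 * k) (sym m≡) (≤-pred (≤-pred m<N)))
    s⊕2+3j⊕t≡v : s ⊕ (2 + j * 3) ⊕ t ≡ s ⊕ suc m
    s⊕2+3j⊕t≡v = trans (⊕-assoc s (2 + j * 3) t) (cong (λ x → s ⊕ suc x) m≡)

  Gapped : Fin N → Fin N → Set
  Gapped u w = ∃ λ j → j ≤ k × w ≡ u ⊕ suc (j * 3)

  Aligned : Fin N → Fin N → Set
  Aligned u w = ∃ λ c → u ∈ progression c × w ∈ progression c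

  aligned-sym : ∀ {u w} → Aligned u w → Aligned w u
  aligned-sym (c , u∈ , w∈) = c , w∈ , u∈

  aligned-⊕ : ∀ u {i} → i ≤ k → Aligned u (u ⊕ i * 3)
  aligned-⊕ u {i} i≤k =
    prev u , subst (_∈ progression (prev u)) (trans (prev⊕suc u 0) (⊕-identityʳ u)) (∈-run (prev u) (suc k) (s≤s z≤n))
           , subst (_∈ progression (prev u)) (prev⊕suc u (i * 3)) (∈-run (prev u) (suc k) (s≤s i≤k))

  quotient≤k : ∀ r q → r + q * 3 < N → q ≤ k
  quotient≤k r q lt = ≤-pred (quotient<-cancel r q (<-≤-trans lt N≤[1+k]*3))

  gapped-or-aligned : ∀ u w → Gapped u w ⊎ Aligned u w
  gapped-or-aligned u w with offset u w
  ... | d , d<N , w≡u⊕d with divMod3 d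
  ...   | 3q   q = inj₂ (subst (Aligned u) (sym w≡u⊕d) (aligned-⊕ u (quotient≤k 0 q d<N)))
  ...   | 3q+1 q = inj₁ (q , quotient≤k 1 q d<N , w≡u⊕d)
  ...   | 3q+2 q = inj₂ (aligned-sym (subst (Aligned w) w⊕[k∸q]*3≡u (aligned-⊕ w (m∸n≤m k q))))
    where
    open ≡-Reasoning
    one-lap : 2 + q * 3 + (k ∸ q) * 3 ≡ N
    one-lap = begin
      2 + q * 3 + (k ∸ q) * 3    ≡⟨ cong (2 +_) (*-distribʳ-+ 3 q (k ∸ q)) ⟨
      2 + (q + (k ∸ q)) * 3      ≡⟨ cong (λ x → 2 + x * 3) (m+[n∸m]≡n (quotient≤k 2 q d<N)) ⟩
      2 + k * 3                  ≡⟨ cong (2 +_) (*-comm k 3) ⟩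
      N                          ∎
    w⊕[k∸q]*3≡u : w ⊕ (k ∸ q) * 3 ≡ u
    w⊕[k∸q]*3≡u = begin
      w ⊕ (k ∸ q) * 3                  ≡⟨ cong (_⊕ (k ∸ q) * 3) w≡u⊕d ⟩
      u ⊕ (2 + q * 3) ⊕ (k ∸ q) * 3    ≡⟨ ⊕-assoc u (2 + q * 3) ((k ∸ q) * 3) ⟩
      u ⊕ (2 + q * 3 + (k ∸ q) * 3)    ≡⟨ cong (u ⊕_) one-lap ⟩
      u ⊕ N                            ≡⟨ ⊕-N u ⟩
      u                                ∎

  Split : Fin N → Fin N → Set
  Split a b = ∃ λ x → Gapped x a × Aligned x b

  prev-gapped : ∀ a → Gapped (prev a) a
  prev-gapped a = 0 , z≤n , sym (trans (prev⊕suc a 0) (⊕-identityʳ a))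

  distinct⇒split : ∀ {a b} → a ≢ b → Split a b ⊎ Split b a
  distinct⇒split {a} {b} a≢b with gapped-or-aligned (prev a) b
  ... | inj₂ prev-a≈b = inj₁ (prev a , prev-gapped a , prev-a≈b)
  ... | inj₁ (zero , _ , b≡) = contradiction (sym (trans b≡ (trans (prev⊕suc a 0) (⊕-identityʳ a)))) a≢b
  ... | inj₁ (suc i , 1+i≤k , b≡) =
    inj₂ (prev b , prev-gapped b , subst (Aligned (prev b)) prev-b⊕3t≡a (aligned-⊕ (prev b) (m∸n≤m k i)))
    where
    open ≡-Reasoning
    t = k ∸ i
    two-laps-in : ∀ i t → suc i * 3 + (suc (3 * (i + t)) + t * 3) ≡ suc (suc (3 * (i + t))) + suc (suc (3 * (i + t)))
    two-laps-in = solve-∀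
    two-laps : suc i * 3 + (n + t * 3) ≡ N + N
    two-laps = subst (λ m → suc i * 3 + (suc (3 * m) + t * 3) ≡ suc (suc (3 * m)) + suc (suc (3 * m)))
                     (m+[n∸m]≡n (<⇒≤ 1+i≤k)) (two-laps-in i t)
    prev-b⊕3t≡a : prev b ⊕ t * 3 ≡ a
    prev-b⊕3t≡a = begin
      prev b ⊕ t * 3                       ≡⟨ ⊕-assoc b n (t * 3) ⟩
      b ⊕ (n + t * 3)                      ≡⟨ cong (_⊕ (n + t * 3)) (trans b≡ (prev⊕suc a (suc i * 3))) ⟩
      a ⊕ suc i * 3 ⊕ (n + t * 3)          ≡⟨ ⊕-assoc a (suc i * 3) (n + t * 3) ⟩
      a ⊕ (suc i * 3 + (n + t * 3))        ≡⟨ cong (a ⊕_) two-laps ⟩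
      a ⊕ (N + N)                          ≡⟨ ⊕-assoc a N N ⟨
      a ⊕ N ⊕ N                            ≡⟨ trans (⊕-N (a ⊕ N)) (⊕-N a) ⟩
      a                                    ∎

  module _ (f : Fin N → Fin N) where
    F : Graph
    F = Functigraph C f

    SmallDominatingSet : Set
    SmallDominatingSet = ∃ λ D → Dominating F D × ∣ D ∣ ≤ k + suc k

    split⇒small : ∀ {a b} → Split a b → f a ≡ f b → SmallDominatingSet
    split⇒small {a} {b} (x , (j , j≤k , a≡) , c , x∈ , b∈) fa≡fb with gapped-or-aligned (f x) (f a)
    ... | inj₂ (c′ , fx∈ , fa∈) =
      gapped x j ++ progression c′ ,
      functigraph-dominating C f _ _ cover₁ (λ v → inj₁ (progression-dominating c′ v)) ,
      ≤-trans (≤-reflexive (∣p++q∣≡∣p∣+∣q∣ (gapped x j) _)) (+-mono-≤ (∣gapped∣≤k x j≤k) (∣run∣≤ c′ (suc k)))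
      where
      cover₁ : ∀ v → Dominated C (gapped x j) v ⊎ f v ∈ progression c′
      cover₁ v with gapped-dominates x j≤k v
      ... | inj₁ refl            = inj₂ fx∈
      ... | inj₂ (inj₁ refl)     = inj₂ (subst (λ y → f y ∈ progression c′) a≡ fa∈)
      ... | inj₂ (inj₂ dominated) = inj₁ dominated
    ... | inj₁ (j′ , j′≤k , fa≡) =
      progression c ++ gapped (f x) j′ ,
      functigraph-dominating C f _ _ (λ v → inj₁ (progression-dominating c v)) cover₂ ,
      ≤-trans (≤-reflexive (trans (∣p++q∣≡∣p∣+∣q∣ (progression c) _) (+-comm ∣ progression c ∣ ∣ gapped (f x) j′ ∣)))
              (+-mono-≤ (∣gapped∣≤k (f x) j′≤k) (∣run∣≤ c (suc k)))
      where
      cover₂ : ∀ v → Dominated C (gapped (f x) j′) v ⊎ ∃ λ u → u ∈ progression c × f u ≡ v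
      cover₂ v with gapped-dominates (f x) j′≤k v
      ... | inj₁ refl            = inj₂ (x , x∈ , refl)
      ... | inj₂ (inj₁ refl)     = inj₂ (b , b∈ , trans (sym fa≡fb) fa≡)
      ... | inj₂ (inj₂ dominated) = inj₁ dominated

    non-bijective⇒small : ¬ Bijective _≡_ _≡_ f → SmallDominatingSet
    non-bijective⇒small ¬bij with ¬bijective⇒collision ¬bij
    ... | a , b , a≢b , fa≡fb with distinct⇒split a≢b
    ...   | inj₁ split = split⇒small split fa≡fb
    ...   | inj₂ split = split⇒small split (sym fa≡fb)

theorem4p5 : (k : ℕ) → 1 Data.Nat.≤ k → (f : Fin (3 * k + 2) → Fin (3 * k + 2)) → ¬ Bijective _≡_ _≡_ f → (γF γC : ℕ) → IsDominationNumber (Functigraph (Cycle (3 * k + 2)) f) γF → IsDominationNumber (Cycle (3 * k + 2)) γC → (γF < 2 * γC) × (2 * γC ≡ 2 * k + 2)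
theorem4p5 k _ rewrite +-comm (3 * k) 2 = λ f ¬bij γF γC (_ , γF-minimal) γC-is →
  let open Cycle3k+2 k
      D , D-dominating , ∣D∣≤2k+1 = non-bijective⇒small f ¬bij
      2γC≡2k+2 = trans (cong (2 *_) (cycle-domination-number γC-is)) (2[1+k]≡2k+2 k)
  in ≤-trans (s≤s (≤-trans (γF-minimal D D-dominating) ∣D∣≤2k+1)) (≤-reflexive (trans (1+k+[1+k]≡2k+2 k) (sym 2γC≡2k+2)))
   , 2γC≡2k+2
  where
  2[1+k]≡2k+2 : ∀ k → 2 * suc k ≡ 2 * k + 2
  2[1+k]≡2k+2 = solve-∀
  1+k+[1+k]≡2k+2 : ∀ k → suc (k + suc k) ≡ 2 * k + 2
  1+k+[1+k]≡2k+2 = solve-∀
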